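{- Let $P=(U,R)$ be a partial order. Then $P$ is a linear order if and only if $NC(P)$ is a chain graph.
   Context: $P$ is a strict partial order on $U=\{u_1,\dots,u_n\}$; it is a linear order if every two distinct elements are comparable. With $V=\{v_1,\dots,v_n\}$, $NC(P)=(U,V,E)$ is the bipartite graph with $u_iv_j\in E$ iff $u_i\le_P u_j$ (i.e. $i=j$ or $u_i<_Pu_j$). A bipartite graph is a chain graph if the neighbourhoods of the vertices in each colour class are linearly ordered by inclusion. -}

module Defs where

open import Level using (Level; _⊔_; suc)
open import Data.Nat using (ℕ)
open import Data.Fin using (Fin)
open import Data.Sum using (_⊎_)
open import Relation.Binary.PropositionalEquality using (_≡_)
open import Relation.Binary.Definitions using (Trichotomous)
open import Relation.Binary.Structures using (IsStrictPartialOrder; IsStrictTotalOrder)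

record BipartiteGraph (ℓ : Level) : Set (suc ℓ) where
  field
    m k : ℕ
    E   : Fin m → Fin k → Set ℓ

module _ {ℓ : Level} (G : BipartiteGraph ℓ) where
  open BipartiteGraph G

  NU⊆ : Fin m → Fin m → Set ℓ
  NU⊆ i i' = ∀ j → E i j → E i' j

  NV⊆ : Fin k → Fin k → Set ℓ
  NV⊆ j j' = ∀ i → E i j → E i j'

  IsChainGraph : Set ℓ
  IsChainGraph =
    (∀ i i' → NU⊆ i i' ⊎ NU⊆ i' i) × (∀ j j' → NV⊆ j j' ⊎ NV⊆ j' j)
    where open import Data.Product using (_×_)

_≤[_]_ : ∀ {n ℓ} → Fin n → (Fin n → Fin n → Set ℓ) → Fin n → Set ℓ
i ≤[ _<P_ ] j = (i ≡ j) ⊎ (i <P j)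

NC : ∀ {ℓ} (n : ℕ) → (Fin n → Fin n → Set ℓ) → BipartiteGraph ℓ
NC n _<P_ = record { m = n ; k = n ; E = λ i j → i ≤[ _<P_ ] j }

IsLinear : ∀ {ℓ} {n : ℕ} → (Fin n → Fin n → Set ℓ) → Set ℓ
IsLinear {n = n} _<P_ = ∀ (i j : Fin n) → ¬ (i ≡ j) → (i <P j) ⊎ (j <P i)
  where open import Relation.Nullary using (¬_)

-- In NC(P) the neighbourhood of u_i is the up-set of u_i and that of v_j is the
-- down-set of u_j, so inclusion of neighbourhoods is just the order ≤_P itself
-- (reversed on the U side).  Hence NC(P) is a chain graph iff ≤_P is total,
-- which for a partial order is exactly linearity.
module Submission where

open import Defs
open import Level using (Level)
open import Data.Nat using (ℕ)
open import Data.Fin using (Fin)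
open import Data.Fin.Properties using (_≟_)
open import Data.Sum using (_⊎_; inj₁; inj₂; [_,_]; map)
open import Data.Product using (_,_)
open import Data.Empty using (⊥-elim)
open import Function using (_∘_)
open import Function.Bundles using (_⇔_; mk⇔; module Equivalence)
open import Function.Construct.Composition using (_⇔-∘_)
open import Function.Construct.Symmetry using (⇔-sym)
open import Relation.Nullary using (yes; no)
open import Relation.Binary.Definitions using (Transitive; Total)
open import Relation.Binary.PropositionalEquality using (_≡_; refl; sym)
open import Relation.Binary.Structures using (IsStrictPartialOrder)

module _ {ℓ : Level} {n : ℕ} {_<P_ : Fin n → Fin n → Set ℓ} where

  private
    _≤_ : Fin n → Fin n → Set ℓ
    i ≤ j = i ≤[ _<P_ ] j

  ≤-trans : Transitive _<P_ → Transitive _≤_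
  ≤-trans _       (inj₁ refl) q           = q
  ≤-trans _       (inj₂ p)    (inj₁ refl) = inj₂ p
  ≤-trans <-trans (inj₂ p)    (inj₂ q)    = inj₂ (<-trans p q)

  NU⊆⇔≥ : Transitive _<P_ → ∀ i i' → NU⊆ (NC n _<P_) i i' ⇔ i' ≤ i
  NU⊆⇔≥ <-trans i i' =
    mk⇔ (λ sub → sub i (inj₁ refl)) (λ i'≤i j i≤j → ≤-trans <-trans i'≤i i≤j)

  NV⊆⇔≤ : Transitive _<P_ → ∀ j j' → NV⊆ (NC n _<P_) j j' ⇔ j ≤ j'
  NV⊆⇔≤ <-trans j j' =
    mk⇔ (λ sub → sub j (inj₁ refl)) (λ j≤j' i i≤j → ≤-trans <-trans i≤j j≤j')

  linear⇔≤-total : IsLinear _<P_ ⇔ Total _≤_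
  linear⇔≤-total = mk⇔ total linear
    where
    total : IsLinear _<P_ → Total _≤_
    total lin i j with i ≟ j
    ... | yes i≡j = inj₁ (inj₁ i≡j)
    ... | no  i≢j = [ inj₁ ∘ inj₂ , inj₂ ∘ inj₂ ] (lin i j i≢j)

    linear : Total _≤_ → IsLinear _<P_
    linear tot i j i≢j with tot i j
    ... | inj₁ (inj₁ i≡j) = ⊥-elim (i≢j i≡j)
    ... | inj₁ (inj₂ i<j) = inj₁ i<j
    ... | inj₂ (inj₁ j≡i) = ⊥-elim (i≢j (sym j≡i))
    ... | inj₂ (inj₂ j<i) = inj₂ j<i

  chainGraph⇔≤-total : Transitive _<P_ → IsChainGraph (NC n _<P_) ⇔ Total _≤_
  chainGraph⇔≤-total <-trans =
    mk⇔ (λ (U-chained , _) → U-total U-chained) (λ tot → U-chain tot , V-chain tot)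
    where
    open Equivalence
    NU : ∀ i i' → NU⊆ (NC n _<P_) i i' ⇔ i' ≤ i
    NU = NU⊆⇔≥ <-trans

    NV : ∀ j j' → NV⊆ (NC n _<P_) j j' ⇔ j ≤ j'
    NV = NV⊆⇔≤ <-trans

    U-total : (∀ i i' → NU⊆ (NC n _<P_) i i' ⊎ NU⊆ (NC n _<P_) i' i) → Total _≤_
    U-total chain i i' = map (to (NU i' i)) (to (NU i i')) (chain i' i)

    U-chain : Total _≤_ → ∀ i i' → NU⊆ (NC n _<P_) i i' ⊎ NU⊆ (NC n _<P_) i' i
    U-chain tot i i' = map (from (NU i i')) (from (NU i' i)) (tot i' i)

    V-chain : Total _≤_ → ∀ j j' → NV⊆ (NC n _<P_) j j' ⊎ NV⊆ (NC n _<P_) j' j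
    V-chain tot j j' = map (from (NV j j')) (from (NV j' j)) (tot j j')

lemma9 : ∀ {ℓ : Level} (n : ℕ) (_<P_ : Fin n → Fin n → Set ℓ) →
    IsStrictPartialOrder _≡_ _<P_ →
    IsLinear _<P_ ⇔ IsChainGraph (NC n _<P_)
lemma9 n _<P_ sp =
  ⇔-sym (chainGraph⇔≤-total (IsStrictPartialOrder.trans sp)) ⇔-∘ linear⇔≤-total
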